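{- Fix an integer $k\ge3$ and suppose $d\mid k$ with $d<k$. For every prime $p>k$ there exists a $k$-gon $[a_0,\dots,a_{k-1}]$ modulo $p$ with monodromy group isomorphic to $C_p^{k-d}\rtimes C_k$.
   Context: A $k$-tuple of positive integers $[a_0,\dots,a_{k-1}]$ ($k\ge3$) is a (geometric) $k$-gon modulo $n$ if $\sum a_i=(k-2)n$, $a_i<2n$, $a_i\ne n$ for all $i$, and $\gcd(a_0,\dots,a_{k-1},n)=1$. Its monodromy group is $N\rtimes C_k$, where $N\subseteq(\mathbb{Z}/n\mathbb{Z})^k$ is the additive subgroup generated by the columns of the circulant matrix with $(i,j)$ entry $a_{(i-j)\bmod k}$, and $C_k$ acts by cyclic permutation of coordinates (equivalently, the monodromy group of the dessin on the polygon's billiards surface). $C_m$ is the cyclic group of order $m$. -}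

module Defs where

open import Data.Nat as ℕ using (ℕ; _<_; _≤_; NonZero)
open import Data.Nat.DivMod using (_%_; m%n<n)
open import Data.Nat.GCD using (gcd)
open import Data.Integer as ℤ using (ℤ; +_; _-_)
open import Data.Integer.Divisibility using (_∣_)
open import Data.Fin using (Fin; toℕ; fromℕ<)
open import Data.List using (List; foldr; map; allFin)
open import Data.Product using (Σ; ∃; _×_)
open import Relation.Binary.PropositionalEquality using (_≡_; _≢_)

sumℕ : ∀ {k} → (Fin k → ℕ) → ℕ
sumℕ {k} f = foldr ℕ._+_ 0 (map f (allFin k))

sumℤ : ∀ {k} → (Fin k → ℤ) → ℤ
sumℤ {k} f = foldr ℤ._+_ (+ 0) (map f (allFin k))

gcdAll : ∀ {k} → (Fin k → ℕ) → ℕ → ℕ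
gcdAll {k} a n = foldr gcd n (map a (allFin k))

IsKGon : (k n : ℕ) → (Fin k → ℕ) → Set
IsKGon k n a =
  (∀ i → 0 < a i) ×
  (sumℕ a ≡ (k ℕ.∸ 2) ℕ.* n) ×
  (∀ i → a i < 2 ℕ.* n) ×
  (∀ i → a i ≢ n) ×
  (gcdAll a n ≡ 1)

-- (i - j) mod k as an element of Fin k
circIdx : ∀ {k} .{{_ : NonZero k}} → Fin k → Fin k → Fin k
circIdx {k} i j = fromℕ< (m%n<n (toℕ i ℕ.+ (k ℕ.∸ toℕ j)) k)

-- j-th column of the circulant matrix with (i,j) entry a_{(i-j) mod k}
col : ∀ {k} .{{_ : NonZero k}} → (Fin k → ℕ) → Fin k → Fin k → ℤ
col a j i = + (a (circIdx i j))

_≡[mod_]_ : ℤ → ℕ → ℤ → Set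
x ≡[mod p ] y = (+ p) ∣ (x - y)

VecEq : ∀ {m} → ℕ → (Fin m → ℤ) → (Fin m → ℤ) → Set
VecEq p u v = ∀ i → u i ≡[mod p ] v i

_⊕_ : ∀ {m} → (Fin m → ℤ) → (Fin m → ℤ) → (Fin m → ℤ)
(u ⊕ v) i = u i ℤ.+ v i

-- v (a vector representing an element of (ℤ/pℤ)^k) lies in the subgroup N
-- generated by the columns of the circulant matrix of a
InN : ∀ {k} .{{_ : NonZero k}} → ℕ → (Fin k → ℕ) → (Fin k → ℤ) → Set
InN {k} p a v = ∃ λ (c : Fin k → ℤ) →
  ∀ i → v i ≡[mod p ] sumℤ (λ j → c j ℤ.* col a j i)

-- N ≅ C_p^m : an injective group homomorphism (ℤ/p)^m → (ℤ/p)^k with image N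
-- (elements of (ℤ/p)^r represented by integer vectors up to congruence mod p)
NIsoCpPow : ∀ {k} .{{_ : NonZero k}} → ℕ → (Fin k → ℕ) → ℕ → Set
NIsoCpPow {k} p a m = Σ ((Fin m → ℤ) → (Fin k → ℤ)) λ φ →
  (∀ u u' → VecEq p u u' → VecEq p (φ u) (φ u')) ×
  (∀ u u' → VecEq p (φ u) (φ u') → VecEq p u u') ×
  (∀ u u' → VecEq p (φ (u ⊕ u')) (φ u ⊕ φ u')) ×
  (∀ u → InN p a (φ u)) ×
  (∀ v → InN p a v → ∃ λ u → VecEq p v (φ u))

{-# OPTIONS --safe #-}
module Submission where

-- The k-gon is a = (p+d−k, …, p+d−k, p+d, …, p+d, d, d), with d, k−2−d and 2 entries of each kind.
-- Modulo p we have a_m ≡ d − k·[m < d], so its circulant matrix M acts by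
--   (M c)_i ≡ d·Σc − k·W(c)_i,   W(c)_i = c_i + c_{i−1} + … + c_{i−d+1}   (indices modulo k),
-- and W(c)_{i+1} − W(c)_i = c_{i+1} − c_{i+1−d}.  Since p ∤ k, M c ≡ 0 forces W(c) to be constant,
-- i.e. c to be d-periodic; conversely a d-periodic c has constant window with k·W = Σ_i W(c)_i = d·Σc,
-- so M c ≡ 0.  A d-periodic vector vanishing on the last d coordinates is zero, and every vector is
-- such a vector plus a d-periodic one; hence M maps the vectors supported on the first k − d
-- coordinates isomorphically onto N, which is therefore C_p^(k−d).

open import Defs
open import Data.Nat using (ℕ; _<_; _≤_; _∸_; NonZero)
open import Data.Nat.Divisibility using (_∣_)
open import Data.Nat.Primality using (Prime)
open import Data.Fin using (Fin)
open import Data.Product using (∃; _×_)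

open import Level using (0ℓ)
open import Function using (_∘_; id)
open import Data.Bool using (true; false; if_then_else_)
open import Data.Nat as ℕ using (zero; suc; z≤n; s≤s; _<ᵇ_; _<?_)
import Data.Nat.Properties as ℕP
open import Data.Nat.DivMod
  using (_%_; m%n<n; m%n%n≡m%n; %-distribˡ-+; [m+n]%n≡m%n; m<n⇒m%n≡m; m∣n⇒o%n%m≡o%m; %-remove-+ˡ)
import Data.Nat.Divisibility as ℕ∣
open import Data.Nat.GCD using (gcd; gcd[m,n]∣m; gcd[m,n]∣n)
open import Data.Nat.Primality using (euclidsLemma; prime⇒irreducible)
open import Data.Integer as ℤ using (ℤ; +_; _+_; _*_; _-_; -_; ∣_∣)
import Data.Integer.Properties as ℤP
import Data.Integer.Divisibility.Signed as ℤ∣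
open import Data.Integer.Tactic.RingSolver using (solve-∀)
open import Data.Fin using (zero; suc; toℕ; fromℕ<; inject≤)
import Data.Fin.Properties as FinP
import Data.Fin.Permutation as Perm
open import Data.List as List using (List; []; _∷_; allFin)
import Data.List.Properties as ListP
open import Data.List.Membership.Propositional using (_∈_)
open import Data.List.Membership.Propositional.Properties using (∈-map⁺; ∈-allFin)
open import Data.List.Relation.Unary.Any using (here; there)
import Data.Vec.Functional as Vector
open import Data.Sum using (_⊎_; inj₁; inj₂)
open import Data.Product using (_,_; proj₁; proj₂)
open import Algebra.Bundles using (CommutativeRing; AbelianGroup)
open import Algebra.Structures using (IsCommutativeRing)
import Algebra.Properties.Group
import Algebra.Properties.Semiring.Sum
open import Relation.Nullary using (¬_; Dec; yes; no; contradiction)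
open import Relation.Binary.Bundles using (Setoid)
import Relation.Binary.Reasoning.Setoid
open import Relation.Binary.PropositionalEquality
  using (_≡_; _≢_; refl; sym; trans; cong; cong₂; subst; subst₂; module ≡-Reasoning)

open import Algebra.Properties.Semiring.Sum ℤP.+-*-semiring
  using (sum; sum-syntax; sum-cong-≗; sum-init-last; sum-replicate-zero; ∑-distrib-+; ∑-comm;
         *-distribˡ-sum; sum-permute)
open Algebra.Properties.Group (AbelianGroup.group ℤP.+-0-abelianGroup) using ()
  renaming (∙-cancelʳ to +-cancelʳ)

foldr-map-allFin : ∀ {A B : Set} (_∙_ : A → B → B) (ε : B) {n} (f : Fin n → A) →
  List.foldr _∙_ ε (List.map f (allFin n)) ≡ Vector.foldr _∙_ ε f
foldr-map-allFin {A} _∙_ ε f = trans (cong (List.foldr _∙_ ε) (ListP.map-tabulate id f)) (foldr-tabulate f)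
  where
  foldr-tabulate : ∀ {n} (f : Fin n → A) → List.foldr _∙_ ε (List.tabulate f) ≡ Vector.foldr _∙_ ε f
  foldr-tabulate {zero} f = refl
  foldr-tabulate {suc n} f = cong (f zero ∙_) (foldr-tabulate (f ∘ suc))

sumℤ≡sum : ∀ {n} (f : Fin n → ℤ) → sumℤ f ≡ sum f
sumℤ≡sum = foldr-map-allFin _+_ (+ 0)

pos-sumℕ : ∀ {n} (f : Fin n → ℕ) → + sumℕ f ≡ ∑[ i < n ] (+ f i)
pos-sumℕ f = trans (cong +_ (foldr-map-allFin ℕ._+_ 0 f)) (pos-foldr f)
  where
  pos-foldr : ∀ {n} (f : Fin n → ℕ) → + Vector.foldr ℕ._+_ 0 f ≡ ∑[ i < n ] (+ f i)
  pos-foldr {zero} f = refl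
  pos-foldr {suc n} f = trans (ℤP.pos-+ (f zero) _) (cong (_+_ (+ f zero)) (pos-foldr (f ∘ suc)))

foldr-gcd-∣ : ∀ n (xs : List ℕ) → List.foldr gcd n xs ∣ n
foldr-gcd-∣ n [] = ℕ∣.∣-refl
foldr-gcd-∣ n (x ∷ xs) = ℕ∣.∣-trans (gcd[m,n]∣n x _) (foldr-gcd-∣ n xs)

foldr-gcd-∣-∈ : ∀ n {x} {xs : List ℕ} → x ∈ xs → List.foldr gcd n xs ∣ x
foldr-gcd-∣-∈ n {xs = x ∷ xs} (here refl) = gcd[m,n]∣m x _
foldr-gcd-∣-∈ n {xs = y ∷ ys} (there x∈ys) = ℕ∣.∣-trans (gcd[m,n]∣n y _) (foldr-gcd-∣-∈ n x∈ys)

gcdAll-∣ : ∀ {k} (a : Fin k → ℕ) n → gcdAll a n ∣ n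
gcdAll-∣ {k} a n = foldr-gcd-∣ n (List.map a (allFin k))

gcdAll-∣-entry : ∀ {k} (a : Fin k → ℕ) n i → gcdAll a n ∣ a i
gcdAll-∣-entry a n i = foldr-gcd-∣-∈ n (∈-map⁺ a (∈-allFin i))

[m%n+o]%n≡[m+o]%n : ∀ m o n .{{_ : NonZero n}} → (m % n ℕ.+ o) % n ≡ (m ℕ.+ o) % n
[m%n+o]%n≡[m+o]%n m o n = begin
  (m % n ℕ.+ o) % n         ≡⟨ %-distribˡ-+ (m % n) o n ⟩
  (m % n % n ℕ.+ o % n) % n ≡⟨ cong (λ x → (x ℕ.+ o % n) % n) (m%n%n≡m%n m n) ⟩
  (m % n ℕ.+ o % n) % n     ≡⟨ %-distribˡ-+ m o n ⟨
  (m ℕ.+ o) % n             ∎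
  where open ≡-Reasoning

m+n+[o∸m]≡n+o : ∀ {m n o} → m ≤ o → m ℕ.+ n ℕ.+ (o ∸ m) ≡ n ℕ.+ o
m+n+[o∸m]≡n+o {m} {n} {o} m≤o = begin
  m ℕ.+ n ℕ.+ (o ∸ m)     ≡⟨ cong (ℕ._+ (o ∸ m)) (ℕP.+-comm m n) ⟩
  n ℕ.+ m ℕ.+ (o ∸ m)     ≡⟨ ℕP.+-assoc n m (o ∸ m) ⟩
  n ℕ.+ (m ℕ.+ (o ∸ m))   ≡⟨ cong (n ℕ.+_) (ℕP.m+[n∸m]≡n m≤o) ⟩
  n ℕ.+ o                 ∎
  where open ≡-Reasoning

divisor-nonZero : ∀ {m n} .{{_ : NonZero n}} → m ∣ n → NonZero m
divisor-nonZero {zero} {n} 0∣n = contradiction (ℕ∣.0∣⇒≡0 0∣n) (ℕ.≢-nonZero⁻¹ n)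
divisor-nonZero {suc m} _ = _

proper-divisor-+2≤ : ∀ {m n} → 3 ≤ n → m ∣ n → m < n → m ℕ.+ 2 ≤ n
proper-divisor-+2≤ {zero} 3≤n _ _ = ℕP.≤-trans (ℕP.n≤1+n 2) 3≤n
proper-divisor-+2≤ {suc zero} 3≤n _ _ = 3≤n
proper-divisor-+2≤ {m@(suc (suc _))} {n} _ m∣n m<n = begin
  m ℕ.+ 2                  ≤⟨ ℕP.+-monoʳ-≤ m (s≤s (s≤s z≤n)) ⟩
  2 ℕ.* m                  ≤⟨ ℕP.*-monoˡ-≤ m (ℕ∣.quotient>1 m∣n m<n) ⟩
  ℕ∣.quotient m∣n ℕ.* m    ≡⟨ ℕ∣.m∣n⇒n≡quotient*m m∣n ⟨
  n                        ∎
  where open ℕP.≤-Reasoning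

𝟙[_<_] : ℕ → ℕ → ℕ
𝟙[ m < n ] = if m <ᵇ n then 1 else 0

𝟙-< : ∀ {m n} → m < n → 𝟙[ m < n ] ≡ 1
𝟙-< {m} {n} m<n with m <ᵇ n | ℕP.<⇒<ᵇ m<n
... | true | _ = refl

𝟙-≥ : ∀ {m n} → n ≤ m → 𝟙[ m < n ] ≡ 0
𝟙-≥ {m} {n} n≤m with m <ᵇ n | ℕP.<ᵇ⇒< m n
... | false | _ = refl
... | true | <ᵇ⇒< = contradiction (<ᵇ⇒< _) (ℕP.≤⇒≯ n≤m)

sum-𝟙<-* : ∀ {n b} → b ≤ n → (g : ℕ → ℤ) →
  ∑[ m < n ] (+ 𝟙[ toℕ m < b ] * g (toℕ m)) ≡ ∑[ m < b ] g (toℕ m)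
sum-𝟙<-* {n} {zero} _ g = sum-replicate-zero n
sum-𝟙<-* {suc n} {suc b} (s≤s b≤n) g = cong₂ _+_ (ℤP.*-identityˡ (g 0)) (sum-𝟙<-* b≤n (g ∘ suc))

sum-const : ∀ n x → ∑[ i < n ] x ≡ + n * x
sum-const zero x = refl
sum-const (suc n) x = begin
  x + ∑[ i < n ] x        ≡⟨ cong (_+_ x) (sum-const n x) ⟩
  x + + n * x             ≡⟨ cong (_+ + n * x) (ℤP.*-identityˡ x) ⟨
  + 1 * x + + n * x       ≡⟨ ℤP.*-distribʳ-+ x (+ 1) (+ n) ⟨
  + suc n * x             ∎
  where open ≡-Reasoning

sum-𝟙< : ∀ {n b} → b ≤ n → ∑[ m < n ] (+ 𝟙[ toℕ m < b ]) ≡ + b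
sum-𝟙< {n} {b} b≤n = begin
  ∑[ m < n ] (+ 𝟙[ toℕ m < b ])           ≡⟨ sum-cong-≗ {n} (λ m → ℤP.*-identityʳ (+ 𝟙[ toℕ m < b ])) ⟨
  ∑[ m < n ] (+ 𝟙[ toℕ m < b ] * + 1)     ≡⟨ sum-𝟙<-* b≤n (λ _ → + 1) ⟩
  ∑[ m < b ] (+ 1)                        ≡⟨ sum-const b (+ 1) ⟩
  + b * + 1                               ≡⟨ ℤP.*-identityʳ (+ b) ⟩
  + b                                     ∎
  where open ≡-Reasoning

sum-neg : ∀ {n} (f : Fin n → ℤ) → ∑[ i < n ] (- f i) ≡ - sum f
sum-neg f = begin
  ∑[ i < _ ] (- f i)        ≡⟨ sum-cong-≗ (λ i → ℤP.-1*i≡-i (f i)) ⟨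
  ∑[ i < _ ] (ℤ.-1ℤ * f i)  ≡⟨ *-distribˡ-sum ℤ.-1ℤ f ⟨
  ℤ.-1ℤ * sum f             ≡⟨ ℤP.-1*i≡-i (sum f) ⟩
  - sum f                   ∎
  where open ≡-Reasoning

sum-toℕ-init-last : ∀ n (h : ℕ → ℤ) → ∑[ i < suc n ] h (toℕ i) ≡ ∑[ i < n ] h (toℕ i) + h n
sum-toℕ-init-last n h = trans (sum-init-last {n} (h ∘ toℕ))
  (cong₂ _+_ (sum-cong-≗ {n} (cong h ∘ FinP.toℕ-inject₁)) (cong h (FinP.toℕ-fromℕ n)))

sum-rotate : ∀ n (h : ℕ → ℤ) → h n ≡ h 0 → ∑[ i < n ] h (suc (toℕ i)) ≡ ∑[ i < n ] h (toℕ i)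
sum-rotate zero h _ = refl
sum-rotate (suc n) h h[n+1]≡h0 = begin
  ∑[ i < suc n ] h (suc (toℕ i))         ≡⟨ sum-toℕ-init-last n (h ∘ suc) ⟩
  ∑[ i < n ] h (suc (toℕ i)) + h (suc n) ≡⟨ cong (_+_ (∑[ i < n ] h (suc (toℕ i)))) h[n+1]≡h0 ⟩
  ∑[ i < n ] h (suc (toℕ i)) + h 0       ≡⟨ ℤP.+-comm _ (h 0) ⟩
  ∑[ i < suc n ] h (toℕ i)               ∎
  where open ≡-Reasoning

module Congruence (n : ℕ) where

  infix 4 _≈_
  -- A record rather than a synonym, so that x and y can be inferred from a proof of x ≈ y.
  record _≈_ (x y : ℤ) : Set where
    constructor mk≈
    field ≈⇒≡[mod] : x ≡[mod n ] y
  open _≈_ public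

  private
    ≈-via : ∀ {x y} z → z ≡ x - y → + n ℤ∣.∣ z → x ≈ y
    ≈-via z z≡x-y n∣z = mk≈ (ℤ∣.∣⇒∣ᵤ (subst (+ n ℤ∣.∣_) z≡x-y n∣z))

    ∣-diff : ∀ {x y} → x ≈ y → + n ℤ∣.∣ (x - y)
    ∣-diff (mk≈ n∣x-y) = ℤ∣.∣ᵤ⇒∣ n∣x-y

  ≈-refl : ∀ {x} → x ≈ x
  ≈-refl {x} = ≈-via (+ 0) (sym (ℤP.+-inverseʳ x)) (ℤ∣.divides (+ 0) refl)

  ≡⇒≈ : ∀ {x y} → x ≡ y → x ≈ y
  ≡⇒≈ refl = ≈-refl

  ≈-sym : ∀ {x y} → x ≈ y → y ≈ x
  ≈-sym {x} {y} x≈y = ≈-via _ (eq x y) (ℤ∣.∣m⇒∣-m (∣-diff x≈y))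
    where
    eq : ∀ x y → - (x - y) ≡ y - x
    eq = solve-∀

  ≈-trans : ∀ {x y z} → x ≈ y → y ≈ z → x ≈ z
  ≈-trans {x} {y} {z} x≈y y≈z = ≈-via _ (eq x y z) (ℤ∣.∣m∣n⇒∣m+n (∣-diff x≈y) (∣-diff y≈z))
    where
    eq : ∀ x y z → (x - y) + (y - z) ≡ x - z
    eq = solve-∀

  +-cong : ∀ {x y u v} → x ≈ y → u ≈ v → x + u ≈ y + v
  +-cong {x} {y} {u} {v} x≈y u≈v = ≈-via _ (eq x y u v) (ℤ∣.∣m∣n⇒∣m+n (∣-diff x≈y) (∣-diff u≈v))
    where
    eq : ∀ x y u v → (x - y) + (u - v) ≡ (x + u) - (y + v)
    eq = solve-∀

  *-cong : ∀ {x y u v} → x ≈ y → u ≈ v → x * u ≈ y * v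
  *-cong {x} {y} {u} {v} x≈y u≈v =
    ≈-via _ (eq x y u v) (ℤ∣.∣m∣n⇒∣m+n (ℤ∣.∣m⇒∣m*n u (∣-diff x≈y)) (ℤ∣.∣n⇒∣m*n y (∣-diff u≈v)))
    where
    eq : ∀ x y u v → (x - y) * u + y * (u - v) ≡ x * u - y * v
    eq = solve-∀

  neg-cong : ∀ {x y} → x ≈ y → - x ≈ - y
  neg-cong {x} {y} x≈y = ≈-via _ (eq x y) (ℤ∣.∣m⇒∣-m (∣-diff x≈y))
    where
    eq : ∀ x y → - (x - y) ≡ - x - - y
    eq = solve-∀

  modulus*≈0 : ∀ x → + n * x ≈ + 0
  modulus*≈0 x = ≈-via _ (sym (ℤP.+-identityʳ (+ n * x))) (ℤ∣.∣m⇒∣m*n x ℤ∣.∣-refl)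

  *-cancelˡ-≈ : Prime n → ∀ {m} → ¬ n ∣ m → ∀ {x y} → + m * x ≈ + m * y → x ≈ y
  *-cancelˡ-≈ n-prime {m} n∤m {x} {y} (mk≈ mx≡my) with euclidsLemma m ∣ x - y ∣ n-prime n∣m∣x-y∣
    where
    eq : ∀ m x y → m * x - m * y ≡ m * (x - y)
    eq = solve-∀
    n∣m∣x-y∣ : n ∣ m ℕ.* ∣ x - y ∣
    n∣m∣x-y∣ = subst (n ∣_) (trans (cong ∣_∣ (eq (+ m) x y)) (ℤP.abs-* (+ m) (x - y))) mx≡my
  ... | inj₁ n∣m = contradiction n∣m n∤m
  ... | inj₂ n∣∣x-y∣ = mk≈ n∣∣x-y∣

  isCommutativeRing : IsCommutativeRing _≈_ _+_ _*_ -_ (+ 0) (+ 1)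
  isCommutativeRing = record
    { isRing = record
      { +-isAbelianGroup = record
        { isGroup = record
          { isMonoid = record
            { isSemigroup = record
              { isMagma = record
                { isEquivalence = record { refl = ≈-refl ; sym = ≈-sym ; trans = ≈-trans }
                ; ∙-cong = +-cong
                }
              ; assoc = λ x y z → ≡⇒≈ (ℤP.+-assoc x y z)
              }
            ; identity = (λ x → ≡⇒≈ (ℤP.+-identityˡ x)) , (λ x → ≡⇒≈ (ℤP.+-identityʳ x))
            }
          ; inverse = (λ x → ≡⇒≈ (ℤP.+-inverseˡ x)) , (λ x → ≡⇒≈ (ℤP.+-inverseʳ x))
          ; ⁻¹-cong = neg-cong
          }
        ; comm = λ x y → ≡⇒≈ (ℤP.+-comm x y)
        }
      ; *-cong = *-cong
      ; *-assoc = λ x y z → ≡⇒≈ (ℤP.*-assoc x y z)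
      ; *-identity = (λ x → ≡⇒≈ (ℤP.*-identityˡ x)) , (λ x → ≡⇒≈ (ℤP.*-identityʳ x))
      ; distrib = (λ x y z → ≡⇒≈ (ℤP.*-distribˡ-+ x y z)) , (λ x y z → ≡⇒≈ (ℤP.*-distribʳ-+ x y z))
      }
    ; *-comm = λ x y → ≡⇒≈ (ℤP.*-comm x y)
    }

ℤmod : ℕ → CommutativeRing 0ℓ 0ℓ
ℤmod n = record { isCommutativeRing = Congruence.isCommutativeRing n }

module _ {a ℓ} (S : Setoid a ℓ) where
  open Setoid S using (Carrier; _≈_) renaming (trans to ≈-trans)

  periodic-≈-below-window : ∀ d .{{_ : NonZero d}} b (h : ℕ → Carrier) {z} →
    (∀ j → h j ≈ h (j ℕ.+ d)) → (∀ j → b ℕ.≤ j → j < b ℕ.+ d → h j ≈ z) →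
    ∀ j → j < b ℕ.+ d → h j ≈ z
  periodic-≈-below-window d b h {z} periodic on-window j = go b j (ℕP.m≤m+n b j)
    where
    go : ∀ n j → b ℕ.≤ n ℕ.+ j → j < b ℕ.+ d → h j ≈ z
    go zero j b≤j j<b+d = on-window j b≤j j<b+d
    go (suc n) j b≤1+n+j j<b+d with b ℕ.≤? j
    ... | yes b≤j = on-window j b≤j j<b+d
    ... | no b≰j = ≈-trans (periodic j) (go n (j ℕ.+ d) b≤n+[j+d] (ℕP.+-monoˡ-< d (ℕP.≰⇒> b≰j)))
      where
      1+j≤j+d : suc j ℕ.≤ j ℕ.+ d
      1+j≤j+d = subst (ℕ._≤ j ℕ.+ d) (ℕP.+-comm j 1) (ℕP.+-monoʳ-≤ j (ℕ.>-nonZero⁻¹ d))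
      b≤n+[j+d] : b ℕ.≤ n ℕ.+ (j ℕ.+ d)
      b≤n+[j+d] =
        ℕP.≤-trans b≤1+n+j (subst (ℕ._≤ n ℕ.+ (j ℕ.+ d)) (ℕP.+-suc n j) (ℕP.+-monoʳ-≤ n 1+j≤j+d))

module Cyclic (k : ℕ) .{{_ : NonZero k}} where

  -- c (circIdx i j) is by definition cyc c (toℕ i ℕ.+ (k ∸ toℕ j)), the entry c_{i−j}.
  cyc : ∀ {A : Set} → (Fin k → A) → ℕ → A
  cyc v n = v (fromℕ< (m%n<n n k))

  cyc-cong : ∀ {A : Set} (v : Fin k → A) {m n} → m % k ≡ n % k → cyc v m ≡ cyc v n
  cyc-cong v m%k≡n%k = cong v (FinP.fromℕ<-cong _ _ m%k≡n%k _ _)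

  cyc-toℕ : ∀ {A : Set} (v : Fin k → A) i → cyc v (toℕ i) ≡ v i
  cyc-toℕ v i = cong v (trans (FinP.fromℕ<-cong _ _ (m<n⇒m%n≡m (FinP.toℕ<n i)) _ (FinP.toℕ<n i))
                               (FinP.fromℕ<-toℕ i _))

  cyc-+k : ∀ {A : Set} (v : Fin k → A) n → cyc v (n ℕ.+ k) ≡ cyc v n
  cyc-+k v n = cyc-cong v ([m+n]%n≡m%n n k)

  toℕ-circIdx : ∀ i j → toℕ (circIdx i j) ≡ (toℕ i ℕ.+ (k ∸ toℕ j)) % k
  toℕ-circIdx i j = FinP.toℕ-fromℕ< _

  circIdx-+ : ∀ i j → (toℕ (circIdx i j) ℕ.+ toℕ j) % k ≡ toℕ i
  circIdx-+ i j = begin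
    (toℕ (circIdx i j) ℕ.+ J) % k        ≡⟨ cong (λ x → (x ℕ.+ J) % k) (toℕ-circIdx i j) ⟩
    ((I ℕ.+ (k ∸ J)) % k ℕ.+ J) % k      ≡⟨ [m%n+o]%n≡[m+o]%n (I ℕ.+ (k ∸ J)) J k ⟩
    (I ℕ.+ (k ∸ J) ℕ.+ J) % k            ≡⟨ cong (_% k) (ℕP.+-assoc I (k ∸ J) J) ⟩
    (I ℕ.+ ((k ∸ J) ℕ.+ J)) % k          ≡⟨ cong (λ x → (I ℕ.+ x) % k) (ℕP.m∸n+n≡m (ℕP.<⇒≤ (FinP.toℕ<n j))) ⟩
    (I ℕ.+ k) % k                        ≡⟨ [m+n]%n≡m%n I k ⟩
    I % k                                ≡⟨ m<n⇒m%n≡m (FinP.toℕ<n i) ⟩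
    I                                    ∎
    where
    open ≡-Reasoning
    I J : ℕ
    I = toℕ i
    J = toℕ j

  circIdx-involutive : ∀ i j → circIdx i (circIdx i j) ≡ j
  circIdx-involutive i j = FinP.toℕ-injective (begin
    toℕ (circIdx i (circIdx i j))        ≡⟨ toℕ-circIdx i (circIdx i j) ⟩
    (toℕ i ℕ.+ (k ∸ R)) % k              ≡⟨ cong (λ x → (x ℕ.+ (k ∸ R)) % k) (circIdx-+ i j) ⟨
    ((R ℕ.+ J) % k ℕ.+ (k ∸ R)) % k      ≡⟨ [m%n+o]%n≡[m+o]%n (R ℕ.+ J) (k ∸ R) k ⟩
    (R ℕ.+ J ℕ.+ (k ∸ R)) % k            ≡⟨ cong (_% k) (m+n+[o∸m]≡n+o (ℕP.<⇒≤ (FinP.toℕ<n (circIdx i j)))) ⟩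
    (J ℕ.+ k) % k                        ≡⟨ [m+n]%n≡m%n J k ⟩
    J % k                                ≡⟨ m<n⇒m%n≡m (FinP.toℕ<n j) ⟩
    J                                    ∎)
    where
    open ≡-Reasoning
    J R : ℕ
    J = toℕ j
    R = toℕ (circIdx i j)

  sum-reflect : ∀ i (f : Fin k → ℤ) → ∑[ j < k ] f (circIdx i j) ≡ sum f
  sum-reflect i f = sym (sum-permute f (Perm.permutation (circIdx i) (circIdx i)
                                          (circIdx-involutive i) (circIdx-involutive i)))

  sum-cyc-shift : ∀ (f : Fin k → ℤ) s → ∑[ i < k ] cyc f (toℕ i ℕ.+ s) ≡ sum f
  sum-cyc-shift f zero = sum-cong-≗ {k} (λ i → trans (cong (cyc f) (ℕP.+-identityʳ (toℕ i))) (cyc-toℕ f i))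
  sum-cyc-shift f (suc s) = begin
    ∑[ i < k ] cyc f (toℕ i ℕ.+ suc s)     ≡⟨ sum-cong-≗ {k} (λ i → cong (cyc f) (ℕP.+-suc (toℕ i) s)) ⟩
    ∑[ i < k ] cyc f (suc (toℕ i) ℕ.+ s)   ≡⟨ sum-rotate k (λ n → cyc f (n ℕ.+ s)) cyc[k+s]≡cyc[s] ⟩
    ∑[ i < k ] cyc f (toℕ i ℕ.+ s)         ≡⟨ sum-cyc-shift f s ⟩
    sum f                                  ∎
    where
    open ≡-Reasoning
    cyc[k+s]≡cyc[s] : cyc f (k ℕ.+ s) ≡ cyc f (0 ℕ.+ s)
    cyc[k+s]≡cyc[s] = trans (cong (cyc f) (ℕP.+-comm k s)) (cyc-+k f s)

  -- n ℕ.+ (k ∸ m) stands for n − m modulo k.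
  window : ℕ → (Fin k → ℤ) → ℕ → ℤ
  window d c n = ∑[ m < d ] cyc c (n ℕ.+ (k ∸ toℕ m))

  window-step : ∀ d .{{_ : NonZero d}} → d ℕ.≤ k → ∀ c n →
    window d c (suc n) + cyc c (suc n ℕ.+ (k ∸ d)) ≡ cyc c (suc n) + window d c n
  window-step (suc d) d<k c n = begin
    window (suc d) c (suc n) + cyc c (suc n ℕ.+ (k ∸ suc d))
      ≡⟨ cong₂ (λ x y → x + y + cyc c (suc n ℕ.+ (k ∸ suc d))) (cyc-+k c (suc n))
               (sum-cong-≗ {d} (λ m → cong (cyc c) (shift (toℕ m) (ℕP.<-trans (FinP.toℕ<n m) d<k)))) ⟩
    cyc c (suc n) + ∑[ m < d ] cyc c (n ℕ.+ (k ∸ toℕ m)) + cyc c (suc n ℕ.+ (k ∸ suc d))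
      ≡⟨ ℤP.+-assoc (cyc c (suc n)) _ _ ⟩
    cyc c (suc n) + (∑[ m < d ] cyc c (n ℕ.+ (k ∸ toℕ m)) + cyc c (suc n ℕ.+ (k ∸ suc d)))
      ≡⟨ cong (λ x → cyc c (suc n) + (∑[ m < d ] cyc c (n ℕ.+ (k ∸ toℕ m)) + cyc c x)) (shift d d<k) ⟩
    cyc c (suc n) + (∑[ m < d ] cyc c (n ℕ.+ (k ∸ toℕ m)) + cyc c (n ℕ.+ (k ∸ d)))
      ≡⟨ cong (_+_ (cyc c (suc n))) (sum-toℕ-init-last d (λ m → cyc c (n ℕ.+ (k ∸ m)))) ⟨
    cyc c (suc n) + window (suc d) c n
      ∎
    where
    open ≡-Reasoning
    shift : ∀ m → m < k → suc n ℕ.+ (k ∸ suc m) ≡ n ℕ.+ (k ∸ m)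
    shift m m<k = trans (sym (ℕP.+-suc n _)) (cong (n ℕ.+_) (sym (ℕP.+-∸-assoc 1 m<k)))

  window-mod : ∀ d c n → window d c (n % k) ≡ window d c n
  window-mod d c n = sum-cong-≗ {d} (λ m → cyc-cong c ([m%n+o]%n≡[m+o]%n n _ k))

  sum-window : ∀ d c → ∑[ i < k ] window d c (toℕ i) ≡ + d * sum c
  sum-window d c = begin
    ∑[ i < k ] ∑[ m < d ] cyc c (toℕ i ℕ.+ (k ∸ toℕ m))
      ≡⟨ ∑-comm {k} {d} (λ i m → cyc c (toℕ i ℕ.+ (k ∸ toℕ m))) ⟩
    ∑[ m < d ] ∑[ i < k ] cyc c (toℕ i ℕ.+ (k ∸ toℕ m))
      ≡⟨ sum-cong-≗ {d} (λ m → sum-cyc-shift c (k ∸ toℕ m)) ⟩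
    ∑[ m < d ] sum c
      ≡⟨ sum-const d (sum c) ⟩
    + d * sum c
      ∎
    where open ≡-Reasoning

  circulant : (Fin k → ℕ) → (Fin k → ℤ) → Fin k → ℤ
  circulant a c i = ∑[ j < k ] (c j * col a j i)

  circulant-reflect : ∀ a c i → circulant a c i ≡ ∑[ j < k ] (+ a j * cyc c (toℕ i ℕ.+ (k ∸ toℕ j)))
  circulant-reflect a c i = begin
    ∑[ j < k ] (c j * + a (circIdx i j))                           ≡⟨ sum-reflect i _ ⟨
    ∑[ j < k ] (c (circIdx i j) * + a (circIdx i (circIdx i j)))   ≡⟨ sum-cong-≗ {k} reflect-term ⟩
    ∑[ j < k ] (+ a j * c (circIdx i j))                           ∎
    where
    open ≡-Reasoning
    reflect-term : ∀ j → c (circIdx i j) * + a (circIdx i (circIdx i j)) ≡ + a j * c (circIdx i j)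
    reflect-term j = trans (cong (λ x → c (circIdx i j) * + a x) (circIdx-involutive i j))
                           (ℤP.*-comm (c (circIdx i j)) (+ a j))

  circulant-⊕ : ∀ a c₁ c₂ i → circulant a (c₁ ⊕ c₂) i ≡ circulant a c₁ i + circulant a c₂ i
  circulant-⊕ a c₁ c₂ i =
    trans (sum-cong-≗ {k} (λ j → ℤP.*-distribʳ-+ (col a j i) (c₁ j) (c₂ j))) (∑-distrib-+ {k} _ _)

  circulant-⊖ : ∀ a c₁ c₂ i → circulant a (λ j → c₁ j - c₂ j) i ≡ circulant a c₁ i - circulant a c₂ i
  circulant-⊖ a c₁ c₂ i = begin
    ∑[ j < k ] ((c₁ j - c₂ j) * col a j i)
      ≡⟨ sum-cong-≗ {k} (λ j → distrib (c₁ j) (c₂ j) (col a j i)) ⟩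
    ∑[ j < k ] (c₁ j * col a j i + - (c₂ j * col a j i))
      ≡⟨ ∑-distrib-+ {k} _ _ ⟩
    circulant a c₁ i + ∑[ j < k ] (- (c₂ j * col a j i))
      ≡⟨ cong (_+_ (circulant a c₁ i)) (sum-neg {k} _) ⟩
    circulant a c₁ i - circulant a c₂ i
      ∎
    where
    open ≡-Reasoning
    distrib : ∀ x y z → (x - y) * z ≡ x * z + - (y * z)
    distrib = solve-∀

module Polygon (k d p : ℕ) .{{_ : NonZero k}} .{{_ : NonZero d}}
  (d∣k : d ∣ k) (d+2≤k : d ℕ.+ 2 ℕ.≤ k) (k<p : k < p) (p-prime : Prime p) where

  open Cyclic k

  d≤k∸2 : d ℕ.≤ k ∸ 2
  d≤k∸2 = ℕP.m+n≤o⇒m≤o∸n d d+2≤k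

  k∸2<k : k ∸ 2 < k
  k∸2<k = ℕP.∸-monoʳ-< {k} {2} {0} (s≤s z≤n) (ℕP.≤-trans (ℕP.m≤n+m 2 d) d+2≤k)

  d<k : d < k
  d<k = ℕP.≤-<-trans d≤k∸2 k∸2<k

  d<p : d < p
  d<p = ℕP.<-trans d<k k<p

  entry : ℕ → ℕ
  entry m = d ℕ.+ p ℕ.* 𝟙[ m < k ∸ 2 ] ∸ k ℕ.* 𝟙[ m < d ]

  polygon : Fin k → ℕ
  polygon j = entry (toℕ j)

  entry-low : ∀ {m} → m < d → entry m ≡ d ℕ.+ p ∸ k
  entry-low {m} m<d
    rewrite 𝟙-< m<d | 𝟙-< (ℕP.<-≤-trans m<d d≤k∸2) | ℕP.*-identityʳ p | ℕP.*-identityʳ k = refl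

  entry-mid : ∀ {m} → d ℕ.≤ m → m < k ∸ 2 → entry m ≡ d ℕ.+ p
  entry-mid {m} d≤m m<k∸2
    rewrite 𝟙-≥ d≤m | 𝟙-< m<k∸2 | ℕP.*-identityʳ p | ℕP.*-zeroʳ k = refl

  entry-top : ∀ {m} → k ∸ 2 ℕ.≤ m → entry m ≡ d
  entry-top {m} k∸2≤m
    rewrite 𝟙-≥ k∸2≤m | 𝟙-≥ (ℕP.≤-trans d≤k∸2 k∸2≤m) | ℕP.*-zeroʳ p | ℕP.*-zeroʳ k | ℕP.+-identityʳ d = refl

  entry-shape : ∀ m → entry m ℕ.+ k ℕ.* 𝟙[ m < d ] ≡ d ℕ.+ p ℕ.* 𝟙[ m < k ∸ 2 ]
  entry-shape m = ℕP.m∸n+n≡m (k*𝟙≤ m)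
    where
    k*𝟙≤ : ∀ m → k ℕ.* 𝟙[ m < d ] ℕ.≤ d ℕ.+ p ℕ.* 𝟙[ m < k ∸ 2 ]
    k*𝟙≤ m with m <? d
    ... | no m≮d rewrite 𝟙-≥ (ℕP.≮⇒≥ m≮d) | ℕP.*-zeroʳ k = z≤n
    ... | yes m<d rewrite 𝟙-< m<d | 𝟙-< (ℕP.<-≤-trans m<d d≤k∸2) | ℕP.*-identityʳ k | ℕP.*-identityʳ p =
      ℕP.≤-trans (ℕP.<⇒≤ k<p) (ℕP.m≤n+m p d)

  entry-range : ∀ m → (0 < entry m × entry m < p) ⊎ (p < entry m × entry m < 2 ℕ.* p)
  entry-range m with m <? d | m <? k ∸ 2
  ... | yes m<d | _ rewrite entry-low m<d = inj₁ (ℕP.m<n⇒0<n∸m k<d+p , d+p∸k<p)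
    where
    k<d+p : k < d ℕ.+ p
    k<d+p = ℕP.<-≤-trans k<p (ℕP.m≤n+m p d)
    d+p∸k<p : d ℕ.+ p ∸ k < p
    d+p∸k<p = subst (d ℕ.+ p ∸ k <_) (ℕP.m+n∸m≡n k p) (ℕP.∸-monoˡ-< (ℕP.+-monoˡ-< p d<k) (ℕP.<⇒≤ k<d+p))
  ... | no m≮d | yes m<k∸2 rewrite entry-mid (ℕP.≮⇒≥ m≮d) m<k∸2 =
    inj₂ (ℕP.m<n+m p (ℕ.>-nonZero⁻¹ d) ,
          subst (d ℕ.+ p <_) (cong (p ℕ.+_) (sym (ℕP.+-identityʳ p))) (ℕP.+-monoˡ-< p d<p))
  ... | no _ | no m≮k∸2 rewrite entry-top (ℕP.≮⇒≥ m≮k∸2) = inj₁ (ℕ.>-nonZero⁻¹ d , d<p)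

  entry-shapeℤ : ∀ m → + entry m + + k * + 𝟙[ m < d ] ≡ + d + + p * + 𝟙[ m < k ∸ 2 ]
  entry-shapeℤ m = begin
    + entry m + + k * + 𝟙[ m < d ]       ≡⟨ cong (_+_ (+ entry m)) (ℤP.pos-* k _) ⟨
    + entry m + + (k ℕ.* 𝟙[ m < d ])     ≡⟨ ℤP.pos-+ (entry m) _ ⟨
    + (entry m ℕ.+ k ℕ.* 𝟙[ m < d ])     ≡⟨ cong +_ (entry-shape m) ⟩
    + (d ℕ.+ p ℕ.* 𝟙[ m < k ∸ 2 ])       ≡⟨ ℤP.pos-+ d _ ⟩
    + d + + (p ℕ.* 𝟙[ m < k ∸ 2 ])       ≡⟨ cong (_+_ (+ d)) (ℤP.pos-* p _) ⟩
    + d + + p * + 𝟙[ m < k ∸ 2 ]         ∎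
    where open ≡-Reasoning

  polygon-sum : sumℕ polygon ≡ (k ∸ 2) ℕ.* p
  polygon-sum = ℤP.+-injective (+-cancelʳ (+ k * + d) _ _ (begin
    + sumℕ polygon + + k * + d
      ≡⟨ cong₂ _+_ (pos-sumℕ polygon) (cong (_*_ (+ k)) (sym (sum-𝟙< (ℕP.<⇒≤ d<k)))) ⟩
    ∑[ j < k ] E j + + k * ∑[ j < k ] L j
      ≡⟨ cong (_+_ (∑[ j < k ] E j)) (*-distribˡ-sum (+ k) L) ⟩
    ∑[ j < k ] E j + ∑[ j < k ] (+ k * L j)
      ≡⟨ ∑-distrib-+ {k} E (λ j → + k * L j) ⟨
    ∑[ j < k ] (E j + + k * L j)
      ≡⟨ sum-cong-≗ {k} (entry-shapeℤ ∘ toℕ) ⟩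
    ∑[ j < k ] (+ d + + p * M j)
      ≡⟨ ∑-distrib-+ {k} (λ _ → + d) (λ j → + p * M j) ⟩
    ∑[ j < k ] (+ d) + ∑[ j < k ] (+ p * M j)
      ≡⟨ cong₂ _+_ (sym (sum-const k (+ d))) (*-distribˡ-sum (+ p) M) ⟨
    + k * + d + + p * ∑[ j < k ] M j
      ≡⟨ cong (λ x → + k * + d + + p * x) (sum-𝟙< (ℕP.<⇒≤ k∸2<k)) ⟩
    + k * + d + + p * + (k ∸ 2)
      ≡⟨ ℤP.+-comm (+ k * + d) _ ⟩
    + p * + (k ∸ 2) + + k * + d
      ≡⟨ cong (_+ + k * + d) (trans (ℤP.pos-* (k ∸ 2) p) (ℤP.*-comm (+ (k ∸ 2)) (+ p))) ⟨
    + ((k ∸ 2) ℕ.* p) + + k * + d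
      ∎))
    where
    open ≡-Reasoning
    E L M : Fin k → ℤ
    E j = + polygon j
    L j = + 𝟙[ toℕ j < d ]
    M j = + 𝟙[ toℕ j < k ∸ 2 ]

  polygon-gcd : gcdAll polygon p ≡ 1
  polygon-gcd with prime⇒irreducible p-prime (gcdAll-∣ polygon p)
  ... | inj₁ g≡1 = g≡1
  ... | inj₂ g≡p =
    contradiction (subst₂ _∣_ g≡p polygon-penultimate≡d (gcdAll-∣-entry polygon p penultimate)) (ℕ∣.>⇒∤ d<p)
    where
    penultimate : Fin k
    penultimate = fromℕ< k∸2<k
    polygon-penultimate≡d : polygon penultimate ≡ d
    polygon-penultimate≡d = entry-top (ℕP.≤-reflexive (sym (FinP.toℕ-fromℕ< k∸2<k)))

  entry-admissible : ∀ m → 0 < entry m × entry m < 2 ℕ.* p × entry m ≢ p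
  entry-admissible m with entry-range m
  ... | inj₁ (0<e , e<p) = 0<e , ℕP.<-≤-trans e<p (ℕP.m≤m+n p _) , ℕP.<⇒≢ e<p
  ... | inj₂ (p<e , e<2p) = ℕP.≤-<-trans z≤n p<e , e<2p , ℕP.>⇒≢ p<e

  polygon-isKGon : IsKGon k p polygon
  polygon-isKGon = (λ j → proj₁ (entry-admissible (toℕ j))) , polygon-sum ,
                   (λ j → proj₁ (proj₂ (entry-admissible (toℕ j)))) ,
                   (λ j → proj₂ (proj₂ (entry-admissible (toℕ j)))) , polygon-gcd

  private
    module ℤ/p = CommutativeRing (ℤmod p)
    module ≈-Reasoning = Relation.Binary.Reasoning.Setoid ℤ/p.setoid
  open Congruence p using (_≈_; mk≈; ≈⇒≡[mod]; ≡⇒≈; modulus*≈0; *-cancelˡ-≈)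
  open Algebra.Properties.Semiring.Sum ℤ/p.semiring using () renaming (sum-cong-≋ to sum-cong-≈)
  open Algebra.Properties.Group ℤ/p.+-group using ()
    renaming (∙-cancelˡ to +-cancelˡ-≈; ∙-cancelʳ to +-cancelʳ-≈;
              x∙y⁻¹≈ε⇒x≈y to x-y≈0⇒x≈y; x≈y⇒x∙y⁻¹≈ε to x≈y⇒x-y≈0)

  d≤k : d ℕ.≤ k
  d≤k = ℕP.<⇒≤ d<k

  p∤k : ¬ p ∣ k
  p∤k = ℕ∣.>⇒∤ k<p

  m+d+[k∸d]≡m+k : ∀ m → m ℕ.+ d ℕ.+ (k ∸ d) ≡ m ℕ.+ k
  m+d+[k∸d]≡m+k m = trans (ℕP.+-assoc m d _) (cong (m ℕ.+_) (ℕP.m+[n∸m]≡n d≤k))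

  m+[k∸d]+d≡m+k : ∀ m → m ℕ.+ (k ∸ d) ℕ.+ d ≡ m ℕ.+ k
  m+[k∸d]+d≡m+k m = trans (ℕP.+-assoc m _ d) (cong (m ℕ.+_) (ℕP.m∸n+n≡m d≤k))

  entry≈ : ∀ m → + entry m + + k * + 𝟙[ m < d ] ≈ + d
  entry≈ m = begin
    + entry m + + k * + 𝟙[ m < d ]     ≡⟨ entry-shapeℤ m ⟩
    + d + + p * + 𝟙[ m < k ∸ 2 ]       ≈⟨ ℤ/p.+-congˡ {+ d} (modulus*≈0 (+ 𝟙[ m < k ∸ 2 ])) ⟩
    + d + + 0                          ≡⟨ ℤP.+-identityʳ (+ d) ⟩
    + d                                ∎
    where open ≈-Reasoning

  circulant-polygon : ∀ c i → circulant polygon c i + + k * window d c (toℕ i) ≈ + d * sum c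
  circulant-polygon c i = begin
    circulant polygon c i + + k * window d c (toℕ i)
      ≡⟨ cong₂ _+_ (circulant-reflect polygon c i) (cong (_*_ (+ k)) (sym (sum-𝟙<-* d≤k x))) ⟩
    ∑[ j < k ] (+ polygon j * x (toℕ j)) + + k * ∑[ j < k ] (+ 𝟙[ toℕ j < d ] * x (toℕ j))
      ≡⟨ cong (_+_ (∑[ j < k ] (+ polygon j * x (toℕ j))))
              (*-distribˡ-sum {k} (+ k) (λ j → + 𝟙[ toℕ j < d ] * x (toℕ j))) ⟩
    ∑[ j < k ] (+ polygon j * x (toℕ j)) + ∑[ j < k ] (+ k * (+ 𝟙[ toℕ j < d ] * x (toℕ j)))
      ≡⟨ ∑-distrib-+ {k} _ _ ⟨
    ∑[ j < k ] (+ polygon j * x (toℕ j) + + k * (+ 𝟙[ toℕ j < d ] * x (toℕ j)))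
      ≡⟨ sum-cong-≗ {k} (λ j → factor (+ polygon j) (+ k) (+ 𝟙[ toℕ j < d ]) (x (toℕ j))) ⟩
    ∑[ j < k ] ((+ polygon j + + k * + 𝟙[ toℕ j < d ]) * x (toℕ j))
      ≈⟨ sum-cong-≈ {k} (λ j → ℤ/p.*-congʳ {x (toℕ j)} (entry≈ (toℕ j))) ⟩
    ∑[ j < k ] (+ d * x (toℕ j))
      ≡⟨ *-distribˡ-sum {k} (+ d) (x ∘ toℕ) ⟨
    + d * ∑[ j < k ] x (toℕ j)
      ≡⟨ cong (_*_ (+ d)) (sum-reflect i c) ⟩
    + d * sum c
      ∎
    where
    open ≈-Reasoning
    x : ℕ → ℤ
    x m = cyc c (toℕ i ℕ.+ (k ∸ m))
    factor : ∀ e k l x → e * x + k * (l * x) ≡ (e + k * l) * x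
    factor = solve-∀

  circulant-cong : ∀ {c₁ c₂} → (∀ j → c₁ j ≈ c₂ j) → ∀ i → circulant polygon c₁ i ≈ circulant polygon c₂ i
  circulant-cong c₁≈c₂ i = sum-cong-≈ {k} (λ j → ℤ/p.*-congʳ (c₁≈c₂ j))

  module Kernel (g : Fin k → ℤ) (g∈ker : ∀ i → circulant polygon g i ≈ + 0) where

    k*window≈ : ∀ n → + k * window d g n ≈ + d * sum g
    k*window≈ n = begin
      + k * window d g n
        ≡⟨ cong (_*_ (+ k)) (trans (cong (window d g) (FinP.toℕ-fromℕ< _)) (window-mod d g n)) ⟨
      + k * window d g (toℕ i)                         ≈⟨ ℤ/p.+-identityˡ _ ⟨
      + 0 + + k * window d g (toℕ i)                   ≈⟨ ℤ/p.+-congʳ (g∈ker i) ⟨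
      circulant polygon g i + + k * window d g (toℕ i) ≈⟨ circulant-polygon g i ⟩
      + d * sum g                                      ∎
      where
      open ≈-Reasoning
      i : Fin k
      i = fromℕ< (m%n<n n k)

    window-suc≈ : ∀ n → window d g (suc n) ≈ window d g n
    window-suc≈ n = *-cancelˡ-≈ p-prime p∤k (ℤ/p.trans (k*window≈ (suc n)) (ℤ/p.sym (k*window≈ n)))

    cyc-suc-shift≈ : ∀ n → cyc g (suc n ℕ.+ (k ∸ d)) ≈ cyc g (suc n)
    cyc-suc-shift≈ n = +-cancelˡ-≈ (window d g n) _ _ (begin
      window d g n + cyc g (suc n ℕ.+ (k ∸ d))        ≈⟨ ℤ/p.+-congʳ (window-suc≈ n) ⟨
      window d g (suc n) + cyc g (suc n ℕ.+ (k ∸ d))  ≡⟨ window-step d d≤k g n ⟩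
      cyc g (suc n) + window d g n                    ≈⟨ ℤ/p.+-comm (cyc g (suc n)) (window d g n) ⟩
      window d g n + cyc g (suc n)                    ∎)
      where open ≈-Reasoning

    periodic : ∀ j → cyc g j ≈ cyc g (j ℕ.+ d)
    periodic j = begin
      cyc g j                      ≡⟨ cyc-+k g j ⟨
      cyc g (j ℕ.+ k)              ≡⟨ cong (cyc g) (m+d+[k∸d]≡m+k j) ⟨
      cyc g (j ℕ.+ d ℕ.+ (k ∸ d))  ≡⟨ cong (λ m → cyc g (m ℕ.+ (k ∸ d))) 1+n≡j+d ⟨
      cyc g (suc n ℕ.+ (k ∸ d))    ≈⟨ cyc-suc-shift≈ n ⟩
      cyc g (suc n)                ≡⟨ cong (cyc g) 1+n≡j+d ⟩
      cyc g (j ℕ.+ d)              ∎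
      where
      open ≈-Reasoning
      n : ℕ
      n = j ℕ.+ ℕ.pred d
      1+n≡j+d : suc n ≡ j ℕ.+ d
      1+n≡j+d = trans (sym (ℕP.+-suc j _)) (cong (j ℕ.+_) (ℕP.suc-pred d))

    vanishes : (∀ j → k ∸ d ℕ.≤ toℕ j → g j ≈ + 0) → ∀ j → g j ≈ + 0
    vanishes top≈0 j = ℤ/p.trans (≡⇒≈ (sym (cyc-toℕ g j)))
      (periodic-≈-below-window ℤ/p.setoid d (k ∸ d) (cyc g) periodic on-top
                               (toℕ j) (below-k (FinP.toℕ<n j)))
      where
      below-k : ∀ {j} → j < k → j < k ∸ d ℕ.+ d
      below-k {j} = subst (j <_) (sym (ℕP.m∸n+n≡m d≤k))
      on-top : ∀ j → k ∸ d ℕ.≤ j → j < k ∸ d ℕ.+ d → cyc g j ≈ + 0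
      on-top j k∸d≤j j<k∸d+d = top≈0 (fromℕ< (m%n<n j k)) (ℕP.≤-trans k∸d≤j (ℕP.≤-reflexive (sym j%k≡j)))
        where
        j%k≡j : toℕ (fromℕ< (m%n<n j k)) ≡ j
        j%k≡j = trans (FinP.toℕ-fromℕ< _) (m<n⇒m%n≡m (subst (j <_) (ℕP.m∸n+n≡m d≤k) j<k∸d+d))

  module Periodic (P : Fin k → ℤ) (periodic : ∀ n → cyc P (n ℕ.+ d) ≡ cyc P n) where

    window-suc : ∀ n → window d P (suc n) ≡ window d P n
    window-suc n = +-cancelʳ (cyc P (suc n)) _ _ (begin
      window d P (suc n) + cyc P (suc n)               ≡⟨ cong (_+_ (window d P (suc n))) cyc-suc-shift ⟨
      window d P (suc n) + cyc P (suc n ℕ.+ (k ∸ d))   ≡⟨ window-step d d≤k P n ⟩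
      cyc P (suc n) + window d P n                     ≡⟨ ℤP.+-comm (cyc P (suc n)) _ ⟩
      window d P n + cyc P (suc n)                     ∎)
      where
      open ≡-Reasoning
      cyc-suc-shift : cyc P (suc n ℕ.+ (k ∸ d)) ≡ cyc P (suc n)
      cyc-suc-shift =
        trans (sym (periodic _)) (trans (cong (cyc P) (m+[k∸d]+d≡m+k (suc n))) (cyc-+k P (suc n)))

    window-const : ∀ n → window d P n ≡ window d P 0
    window-const zero = refl
    window-const (suc n) = trans (window-suc n) (window-const n)

    k*window≡ : ∀ n → + k * window d P n ≡ + d * sum P
    k*window≡ n = begin
      + k * window d P n              ≡⟨ cong (_*_ (+ k)) (window-const n) ⟩
      + k * window d P 0              ≡⟨ sum-const k _ ⟨
      ∑[ i < k ] window d P 0         ≡⟨ sum-cong-≗ {k} (λ i → window-const (toℕ i)) ⟨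
      ∑[ i < k ] window d P (toℕ i)   ≡⟨ sum-window d P ⟩
      + d * sum P                     ∎
      where open ≡-Reasoning

    ∈ker : ∀ i → circulant polygon P i ≈ + 0
    ∈ker i = +-cancelʳ-≈ (+ d * sum P) _ _ (begin
      circulant polygon P i + + d * sum P
        ≡⟨ cong (_+_ (circulant polygon P i)) (k*window≡ (toℕ i)) ⟨
      circulant polygon P i + + k * window d P (toℕ i)  ≈⟨ circulant-polygon P i ⟩
      + d * sum P                                       ≈⟨ ℤ/p.+-identityˡ _ ⟨
      + 0 + + d * sum P                                 ∎)
      where open ≈-Reasoning

  k∸d≤k : k ∸ d ℕ.≤ k
  k∸d≤k = ℕP.m∸n≤m k d

  restrict : (Fin k → ℤ) → Fin (k ∸ d) → ℤ
  restrict c x = c (inject≤ x k∸d≤k)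

  extend : (Fin (k ∸ d) → ℤ) → Fin k → ℤ
  extend u j with toℕ j <? k ∸ d
  ... | yes j<k∸d = u (fromℕ< j<k∸d)
  ... | no _ = + 0

  extend-restrict : ∀ c j → toℕ j < k ∸ d → extend (restrict c) j ≡ c j
  extend-restrict c j j<k∸d with toℕ j <? k ∸ d
  ... | yes _ = cong c (FinP.toℕ-injective (trans (FinP.toℕ-inject≤ _ k∸d≤k) (FinP.toℕ-fromℕ< j<k∸d)))
  ... | no j≮k∸d = contradiction j<k∸d j≮k∸d

  extend-top : ∀ u j → k ∸ d ℕ.≤ toℕ j → extend u j ≡ + 0
  extend-top u j k∸d≤j with toℕ j <? k ∸ d
  ... | yes j<k∸d = contradiction k∸d≤j (ℕP.<⇒≱ j<k∸d)
  ... | no _ = refl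

  restrict-extend : ∀ u x → restrict (extend u) x ≡ u x
  restrict-extend u x with toℕ (inject≤ x k∸d≤k) <? k ∸ d
  ... | yes x<k∸d = cong u (FinP.toℕ-injective (trans (FinP.toℕ-fromℕ< x<k∸d) (FinP.toℕ-inject≤ x k∸d≤k)))
  ... | no x≮k∸d = contradiction (subst (_< k ∸ d) (sym (FinP.toℕ-inject≤ x k∸d≤k)) (FinP.toℕ<n x)) x≮k∸d

  extend-⊕ : ∀ u₁ u₂ j → extend (u₁ ⊕ u₂) j ≡ extend u₁ j + extend u₂ j
  extend-⊕ u₁ u₂ j with toℕ j <? k ∸ d
  ... | yes _ = refl
  ... | no _ = refl

  extend-cong : ∀ {u₁ u₂} → (∀ x → u₁ x ≈ u₂ x) → ∀ j → extend u₁ j ≈ extend u₂ j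
  extend-cong u₁≈u₂ j with toℕ j <? k ∸ d
  ... | yes j<k∸d = u₁≈u₂ (fromℕ< j<k∸d)
  ... | no _ = ℤ/p.refl

  periodicPart : (Fin k → ℤ) → Fin k → ℤ
  periodicPart c j = cyc c (k ∸ d ℕ.+ toℕ j % d)

  cyc-periodicPart : ∀ c n → cyc (periodicPart c) n ≡ cyc c (k ∸ d ℕ.+ n % d)
  cyc-periodicPart c n = cong (λ m → cyc c (k ∸ d ℕ.+ m))
    (trans (cong (_% d) (FinP.toℕ-fromℕ< _)) (m∣n⇒o%n%m≡o%m d k n d∣k))

  periodicPart-periodic : ∀ c n → cyc (periodicPart c) (n ℕ.+ d) ≡ cyc (periodicPart c) n
  periodicPart-periodic c n = trans (cyc-periodicPart c (n ℕ.+ d))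
    (trans (cong (λ m → cyc c (k ∸ d ℕ.+ m)) ([m+n]%n≡m%n n d)) (sym (cyc-periodicPart c n)))

  periodicPart-top : ∀ c j → k ∸ d ℕ.≤ toℕ j → periodicPart c j ≡ c j
  periodicPart-top c j k∸d≤j = trans (cong (λ m → cyc c (k ∸ d ℕ.+ m)) j%d≡j∸[k∸d])
                                 (trans (cong (cyc c) (ℕP.m+[n∸m]≡n k∸d≤j)) (cyc-toℕ c j))
    where
    d∣k∸d : d ∣ k ∸ d
    d∣k∸d = ℕ∣.∣m+n∣m⇒∣n (subst (d ∣_) (sym (ℕP.m+[n∸m]≡n d≤k)) d∣k) ℕ∣.∣-refl
    j%d≡j∸[k∸d] : toℕ j % d ≡ toℕ j ∸ (k ∸ d)
    j%d≡j∸[k∸d] = begin-equality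
      toℕ j % d                            ≡⟨ cong (_% d) (ℕP.m+[n∸m]≡n k∸d≤j) ⟨
      (k ∸ d ℕ.+ (toℕ j ∸ (k ∸ d))) % d    ≡⟨ %-remove-+ˡ (toℕ j ∸ (k ∸ d)) d∣k∸d ⟩
      (toℕ j ∸ (k ∸ d)) % d                ≡⟨ m<n⇒m%n≡m (ℕP.m<n+o⇒m∸n<o (toℕ j) (k ∸ d) j<k∸d+d) ⟩
      toℕ j ∸ (k ∸ d)                      ∎
      where
      open ℕP.≤-Reasoning
      j<k∸d+d : toℕ j < k ∸ d ℕ.+ d
      j<k∸d+d = subst (toℕ j <_) (sym (ℕP.m∸n+n≡m d≤k)) (FinP.toℕ<n j)

  residual : (Fin k → ℤ) → Fin (k ∸ d) → ℤ
  residual c = restrict (λ j → c j - periodicPart c j)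

  decompose : ∀ c j → c j ≡ extend (residual c) j + periodicPart c j
  decompose c j = by-cases (toℕ j <? k ∸ d)
    where
    x-y+y≡x : ∀ x y → x - y + y ≡ x
    x-y+y≡x = solve-∀
    by-cases : Dec (toℕ j < k ∸ d) → c j ≡ extend (residual c) j + periodicPart c j
    by-cases (yes j<k∸d) =
      sym (trans (cong (_+ periodicPart c j) (extend-restrict (λ j → c j - periodicPart c j) j j<k∸d))
                 (x-y+y≡x (c j) (periodicPart c j)))
    by-cases (no j≮k∸d) =
      sym (trans (cong (_+ periodicPart c j) (extend-top _ j (ℕP.≮⇒≥ j≮k∸d)))
                 (trans (ℤP.+-identityˡ _) (periodicPart-top c j (ℕP.≮⇒≥ j≮k∸d))))

  embed : (Fin (k ∸ d) → ℤ) → Fin k → ℤ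
  embed u = circulant polygon (extend u)

  polygon-monodromy : NIsoCpPow p polygon (k ∸ d)
  polygon-monodromy = embed , embed-cong , embed-injective , embed-additive , embed-∈N , embed-onto
    where
    embed-cong : ∀ u₁ u₂ → VecEq p u₁ u₂ → VecEq p (embed u₁) (embed u₂)
    embed-cong _ _ u₁≡u₂ i = ≈⇒≡[mod] (circulant-cong (extend-cong (mk≈ ∘ u₁≡u₂)) i)

    embed-injective : ∀ u₁ u₂ → VecEq p (embed u₁) (embed u₂) → VecEq p u₁ u₂
    embed-injective u₁ u₂ embed≡ x = ≈⇒≡[mod] (x-y≈0⇒x≈y (u₁ x) (u₂ x) (begin
      u₁ x - u₂ x           ≡⟨ cong₂ _-_ (restrict-extend u₁ x) (restrict-extend u₂ x) ⟨
      g (inject≤ x k∸d≤k)   ≈⟨ Kernel.vanishes g g∈ker g-top≈0 (inject≤ x k∸d≤k) ⟩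
      + 0                   ∎))
      where
      open ≈-Reasoning
      g : Fin k → ℤ
      g j = extend u₁ j - extend u₂ j
      g∈ker : ∀ i → circulant polygon g i ≈ + 0
      g∈ker i = ℤ/p.trans (≡⇒≈ (circulant-⊖ polygon (extend u₁) (extend u₂) i))
                          (x≈y⇒x-y≈0 {embed u₁ i} {embed u₂ i} (mk≈ (embed≡ i)))
      g-top≈0 : ∀ j → k ∸ d ℕ.≤ toℕ j → g j ≈ + 0
      g-top≈0 j top = ≡⇒≈ (cong₂ _-_ (extend-top u₁ j top) (extend-top u₂ j top))

    embed-additive : ∀ u₁ u₂ → VecEq p (embed (u₁ ⊕ u₂)) (embed u₁ ⊕ embed u₂)
    embed-additive u₁ u₂ i = ≈⇒≡[mod] (≡⇒≈ (trans
      (sum-cong-≗ {k} (λ j → cong (_* col polygon j i) (extend-⊕ u₁ u₂ j)))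
      (circulant-⊕ polygon (extend u₁) (extend u₂) i)))

    embed-∈N : ∀ u → InN p polygon (embed u)
    embed-∈N u = extend u , λ i → ≈⇒≡[mod] (≡⇒≈ (sym (sumℤ≡sum (λ j → extend u j * col polygon j i))))

    embed-onto : ∀ v → InN p polygon v → ∃ λ u → VecEq p v (embed u)
    embed-onto v (c , v≡Mc) = residual c , λ i → ≈⇒≡[mod] (begin
      v i                                                         ≈⟨ mk≈ (v≡Mc i) ⟩
      sumℤ (λ j → c j * col polygon j i)                          ≡⟨ sumℤ≡sum (λ j → c j * col polygon j i) ⟩
      circulant polygon c i
        ≡⟨ sum-cong-≗ {k} (λ j → cong (_* col polygon j i) (decompose c j)) ⟩
      circulant polygon (extend (residual c) ⊕ periodicPart c) i
        ≡⟨ circulant-⊕ polygon (extend (residual c)) (periodicPart c) i ⟩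
      embed (residual c) i + circulant polygon (periodicPart c) i
        ≈⟨ ℤ/p.+-congˡ {embed (residual c) i} (Periodic.∈ker (periodicPart c) (periodicPart-periodic c) i) ⟩
      embed (residual c) i + + 0                                  ≡⟨ ℤP.+-identityʳ _ ⟩
      embed (residual c) i                                        ∎)
      where open ≈-Reasoning

proposition10 : ∀ (k d p : ℕ) .{{_ : NonZero k}} → 3 ≤ k → d ∣ k → d < k →
    Prime p → k < p →
    ∃ λ (a : Fin k → ℕ) → IsKGon k p a × NIsoCpPow p a (k ∸ d)
proposition10 k d p 3≤k d∣k d<k p-prime k<p = polygon , polygon-isKGon , polygon-monodromy
  where
  instance
    d-nonZero : NonZero d
    d-nonZero = divisor-nonZero d∣k
  open Polygon k d p d∣k (proper-divisor-+2≤ 3≤k d∣k d<k) k<p p-prime
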